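{- For integers $n \ge 0$ and $m \ge 0$, let $X_n$ be a uniformly random binary string of length $n$ (each of the $2^n$ strings equally likely), let $N_{n,m}$ be the number of distinct subsequences of $X_n$ of length $m$, and let $\hat N_{n,m} = \mathbb{E}[N_{n,m}]$ (so $\hat N_{n,m}=0$ when $m>n$). Then for all integers $n \ge 1$ and $1 \le m \le n$, \[ \hat N_{n,m} = \hat N_{n-1,m-1} + \tfrac{1}{2}\hat N_{n-1,m}, \] and the initial conditions are $\hat N_{n,n} = 1$ and $\hat N_{n,0} = 1$ for all $n \ge 0$.
   Context: A subsequence of a string $s = s_0 s_1\cdots s_{n-1}$ is a string $s_{i_1}s_{i_2}\cdots s_{i_m}$ with $0\le i_1<i_2<\dots<i_m\le n-1$ (not necessarily contiguous). Subsequences are counted as distinct strings, i.e. different index choices yielding the same string are counted once; the empty string is the unique subsequence of length $0$. -}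

module Defs where

open import Data.Bool using (Bool; true; false; _≟_)
open import Data.Nat using (ℕ; zero; suc; _^_)
open import Data.Nat.Properties using (m^n≢0)
open import Data.List using (List; []; _∷_; map; _++_; filter; length)
open import Data.Nat.ListAction using (sum)
open import Data.List.Relation.Binary.Sublist.DecPropositional _≟_ using (_⊆_; _⊆?_)
open import Data.Integer using (+_)
open import Data.Rational using (ℚ; _/_)

binStrings : ℕ → List (List Bool)
binStrings zero = [] ∷ []
binStrings (suc n) = map (false ∷_) (binStrings n) ++ map (true ∷_) (binStrings n)

-- w is a subsequence of s  :=  w ⊆ s (order-preserving embedding / sublist)
-- number of distinct subsequences of s of length m: count the distinct
-- binary strings w of length m with w a subsequence of s
numSubseq : List Bool → ℕ → ℕ
numSubseq s m = length (filter (λ w → w ⊆? s) (binStrings m))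

Nhat : ℕ → ℕ → ℚ
Nhat n m = (+ sum (map (λ s → numSubseq s m) (binStrings n))) / (2 ^ n)
  where instance _ = m^n≢0 2 n

module Submission where

-- Write T(n,m) = Σ_{s ∈ {0,1}ⁿ} N(s,m) for the total
-- number of length-m subsequences over all strings of length n, so that
-- N̂(n,m) = T(n,m) / 2ⁿ.  Counting the pairs (s, w) with w ⊆ s the other way
-- round gives T(n,m) = Σ_{w ∈ {0,1}ᵐ} #{s ∈ {0,1}ⁿ | w ⊆ s}.  The inner count
-- depends only on the length of w: the decision procedure for w ⊆ s embeds w
-- greedily, so a string s = a ∷ s' contains b ∷ w iff either a = b and s'
-- contains w, or a ≠ b and s' contains b ∷ w.  Hence the inner count is
-- C(|w|, n) for the Pascal-like function C with C(0,n) = 2ⁿ, C(m+1,0) = 0 and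
-- C(m+1,n+1) = C(m,n) + C(m+1,n), and T(n,m) = 2ᵐ · C(m,n).  This yields
-- T(n+1,m+1) = 2·T(n,m) + T(n,m+1), T(n,n) = 2ⁿ and T(n,0) = 2ⁿ; dividing by
-- 2ⁿ⁺¹ resp. 2ⁿ in ℚ gives the theorem.

open import Defs

module SubsequenceTotals where

  open import Data.Bool using (Bool; true; false; _≟_)
  open import Data.Nat using (ℕ; zero; suc; _+_; _*_; _^_; _≤_; s≤s)
  open import Data.Nat.Properties using (+-identityʳ; *-identityʳ; +-comm; ≤-refl; m≤n⇒m≤1+n)
  open import Data.Nat.ListAction using (sum)
  open import Data.Nat.ListAction.Properties using (sum-++)
  open import Data.Nat.Tactic.RingSolver using (solve-∀)
  open import Data.List using (List; []; _∷_; map; _++_; filter; length)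
  open import Data.List.Properties using (map-++; map-cong; map-∘)
  open import Data.List.Relation.Binary.Sublist.DecPropositional _≟_ using (_⊆?_)
  open import Function using (_∘_)
  open import Level using (Level)
  open import Relation.Nullary using (does)
  open import Relation.Unary using (Pred; Decidable)
  open import Relation.Binary.PropositionalEquality
  open ≡-Reasoning

  private
    variable
      A B : Set

  ∑ : (A → ℕ) → List A → ℕ
  ∑ g xs = sum (map g xs)

  ∑-cong : {g h : A → ℕ} (xs : List A) → (∀ x → g x ≡ h x) → ∑ g xs ≡ ∑ h xs
  ∑-cong xs g≗h = cong sum (map-cong g≗h xs)

  ∑-zero : (xs : List A) → ∑ (λ _ → 0) xs ≡ 0
  ∑-zero []       = refl
  ∑-zero (_ ∷ xs) = ∑-zero xs

  ∑-+ : (g h : A → ℕ) (xs : List A) → ∑ (λ x → g x + h x) xs ≡ ∑ g xs + ∑ h xs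
  ∑-+ g h []       = refl
  ∑-+ g h (x ∷ xs) = begin
    g x + h x + ∑ (λ x → g x + h x) xs ≡⟨ cong (_+_ (g x + h x)) (∑-+ g h xs) ⟩
    g x + h x + (∑ g xs + ∑ h xs)      ≡⟨ interchange (g x) (h x) (∑ g xs) (∑ h xs) ⟩
    g x + ∑ g xs + (h x + ∑ h xs)      ∎
    where
    interchange : (a b p q : ℕ) → a + b + (p + q) ≡ a + p + (b + q)
    interchange = solve-∀

  ∑-swap : (g : A → B → ℕ) (xs : List A) (ys : List B) →
           ∑ (λ x → ∑ (g x) ys) xs ≡ ∑ (λ y → ∑ (λ x → g x y) xs) ys
  ∑-swap g []       ys = sym (∑-zero ys)
  ∑-swap g (x ∷ xs) ys = begin
    ∑ (g x) ys + ∑ (λ x → ∑ (g x) ys) xs           ≡⟨ cong (_+_ (∑ (g x) ys)) (∑-swap g xs ys) ⟩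
    ∑ (g x) ys + ∑ (λ y → ∑ (λ x → g x y) xs) ys   ≡⟨ ∑-+ (g x) (λ y → ∑ (λ x → g x y) xs) ys ⟨
    ∑ (λ y → g x y + ∑ (λ x → g x y) xs) ys        ∎

  ∑-++ : (g : A → ℕ) (xs ys : List A) → ∑ g (xs ++ ys) ≡ ∑ g xs + ∑ g ys
  ∑-++ g xs ys = trans (cong sum (map-++ g xs ys)) (sum-++ (map g xs) (map g ys))

  ∑-map : (g : B → ℕ) (f : A → B) (xs : List A) → ∑ g (map f xs) ≡ ∑ (g ∘ f) xs
  ∑-map g f xs = cong sum (sym (map-∘ xs))

  indicator : Bool → ℕ
  indicator true  = 1
  indicator false = 0

  length-filter : {p : Level} {P : Pred A p} (P? : Decidable P) (xs : List A) →
                  length (filter P? xs) ≡ ∑ (indicator ∘ does ∘ P?) xs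
  length-filter P? []       = refl
  length-filter P? (x ∷ xs) with does (P? x)
  ... | true  = cong suc (length-filter P? xs)
  ... | false = length-filter P? xs

  ∑-binStrings-suc : (n : ℕ) (g : List Bool → ℕ) →
                     ∑ g (binStrings (suc n))
                       ≡ ∑ (g ∘ (false ∷_)) (binStrings n) + ∑ (g ∘ (true ∷_)) (binStrings n)
  ∑-binStrings-suc n g = begin
    ∑ g (map (false ∷_) Bₙ ++ map (true ∷_) Bₙ)    ≡⟨ ∑-++ g (map (false ∷_) Bₙ) (map (true ∷_) Bₙ) ⟩
    ∑ g (map (false ∷_) Bₙ) + ∑ g (map (true ∷_) Bₙ) ≡⟨ cong₂ _+_ (∑-map g (false ∷_) Bₙ) (∑-map g (true ∷_) Bₙ) ⟩
    ∑ (g ∘ (false ∷_)) Bₙ + ∑ (g ∘ (true ∷_)) Bₙ    ∎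
    where Bₙ = binStrings n

  ∑-binStrings-length : (m : ℕ) (F : ℕ → ℕ) →
                        ∑ (F ∘ length) (binStrings m) ≡ 2 ^ m * F m
  ∑-binStrings-length zero    F = refl
  ∑-binStrings-length (suc m) F = begin
    ∑ (F ∘ length) (binStrings (suc m))       ≡⟨ ∑-binStrings-suc m (F ∘ length) ⟩
    ∑ (F ∘ suc ∘ length) (binStrings m) + ∑ (F ∘ suc ∘ length) (binStrings m)
      ≡⟨ cong₂ _+_ (∑-binStrings-length m (F ∘ suc)) (∑-binStrings-length m (F ∘ suc)) ⟩
    2 ^ m * F (suc m) + 2 ^ m * F (suc m)     ≡⟨ double (2 ^ m) (F (suc m)) ⟩
    2 ^ suc m * F (suc m)                     ∎
    where
    double : (x y : ℕ) → x * y + x * y ≡ 2 * x * y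
    double = solve-∀

  -- coverCount m n is the number of strings in {0,1}ⁿ containing a fixed
  -- string of length m as a subsequence (this does not depend on the string).
  coverCount : ℕ → ℕ → ℕ
  coverCount zero    n       = 2 ^ n
  coverCount (suc m) zero    = 0
  coverCount (suc m) (suc n) = coverCount m n + coverCount (suc m) n

  supersequenceCount : List Bool → ℕ → ℕ
  supersequenceCount w n = ∑ (λ s → indicator (does (w ⊆? s))) (binStrings n)

  -- The first letter of s either matches the first letter of w, which is then
  -- embedded there, or is skipped; this is how w ⊆? s decides by computation.
  supersequenceCount≡coverCount : (w : List Bool) (n : ℕ) →
                                  supersequenceCount w n ≡ coverCount (length w) n
  supersequenceCount≡coverCount []          n       =
    trans (∑-binStrings-length n (λ _ → 1)) (*-identityʳ (2 ^ n))
  supersequenceCount≡coverCount (_ ∷ _)     zero    = refl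
  supersequenceCount≡coverCount (false ∷ w) (suc n) =
    trans (∑-binStrings-suc n (λ s → indicator (does (false ∷ w ⊆? s))))
          (cong₂ _+_ (supersequenceCount≡coverCount w n)
                     (supersequenceCount≡coverCount (false ∷ w) n))
  supersequenceCount≡coverCount (true ∷ w)  (suc n) = begin
    ∑ (λ s → indicator (does (true ∷ w ⊆? s))) (binStrings (suc n))
      ≡⟨ ∑-binStrings-suc n (λ s → indicator (does (true ∷ w ⊆? s))) ⟩
    supersequenceCount (true ∷ w) n + supersequenceCount w n
      ≡⟨ +-comm (supersequenceCount (true ∷ w) n) (supersequenceCount w n) ⟩
    supersequenceCount w n + supersequenceCount (true ∷ w) n
      ≡⟨ cong₂ _+_ (supersequenceCount≡coverCount w n)
                   (supersequenceCount≡coverCount (true ∷ w) n) ⟩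
    coverCount (length w) n + coverCount (suc (length w)) n ∎

  coverCount-tooLong : (n m : ℕ) → n ≤ m → coverCount (suc m) n ≡ 0
  coverCount-tooLong zero    m       _         = refl
  coverCount-tooLong (suc n) (suc m) (s≤s n≤m) =
    cong₂ _+_ (coverCount-tooLong n m n≤m) (coverCount-tooLong n (suc m) (m≤n⇒m≤1+n n≤m))

  coverCount-diag : (n : ℕ) → coverCount n n ≡ 1
  coverCount-diag zero    = refl
  coverCount-diag (suc n) = cong₂ _+_ (coverCount-diag n) (coverCount-tooLong n n ≤-refl)

  totalSubseq : ℕ → ℕ → ℕ
  totalSubseq n m = ∑ (λ s → numSubseq s m) (binStrings n)

  -- Double counting: T(n,m) = Σ_w #{s | w ⊆ s} = 2ᵐ · C(m,n).
  totalSubseq≡ : (n m : ℕ) → totalSubseq n m ≡ 2 ^ m * coverCount m n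
  totalSubseq≡ n m = begin
    ∑ (λ s → numSubseq s m) Bₙ
      ≡⟨ ∑-cong Bₙ (λ s → length-filter (_⊆? s) Bₘ) ⟩
    ∑ (λ s → ∑ (λ w → indicator (does (w ⊆? s))) Bₘ) Bₙ
      ≡⟨ ∑-swap (λ s w → indicator (does (w ⊆? s))) Bₙ Bₘ ⟩
    ∑ (λ w → supersequenceCount w n) Bₘ
      ≡⟨ ∑-cong Bₘ (λ w → supersequenceCount≡coverCount w n) ⟩
    ∑ (λ w → coverCount (length w) n) Bₘ
      ≡⟨ ∑-binStrings-length m (λ k → coverCount k n) ⟩
    2 ^ m * coverCount m n ∎
    where
    Bₙ = binStrings n
    Bₘ = binStrings m

  -- The integer form of the recurrence, from C(m+1,n+1) = C(m,n) + C(m+1,n).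
  totalSubseq-step : (n m : ℕ) →
                     totalSubseq (suc n) (suc m) ≡ 2 * totalSubseq n m + totalSubseq n (suc m)
  totalSubseq-step n m
    rewrite totalSubseq≡ (suc n) (suc m) | totalSubseq≡ n m | totalSubseq≡ n (suc m) =
    distribute (2 ^ m) (coverCount m n) (coverCount (suc m) n)
    where
    distribute : (x y z : ℕ) → 2 * x * (y + z) ≡ 2 * (x * y) + 2 * x * z
    distribute = solve-∀

  totalSubseq-diag : (n : ℕ) → totalSubseq n n ≡ 2 ^ n
  totalSubseq-diag n = begin
    totalSubseq n n        ≡⟨ totalSubseq≡ n n ⟩
    2 ^ n * coverCount n n ≡⟨ cong (2 ^ n *_) (coverCount-diag n) ⟩
    2 ^ n * 1              ≡⟨ *-identityʳ (2 ^ n) ⟩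
    2 ^ n                  ∎

  totalSubseq-empty : (n : ℕ) → totalSubseq n 0 ≡ 2 ^ n
  totalSubseq-empty n = trans (totalSubseq≡ n 0) (+-identityʳ (2 ^ n))

module FractionArithmetic where

  open import Data.Nat as ℕ using (ℕ; suc; _+_; _*_; NonZero)
  open import Data.Nat.Properties using (m*n≢0)
  open import Data.Integer as ℤ using (ℤ; +_)
  open import Data.Integer.Properties using (pos-+; pos-*) renaming (*-comm to ℤ-*-comm)
  import Data.Integer.Tactic.RingSolver as ℤ-Solver
  open import Data.Rational using (_/_; ½; 1ℚ; toℚᵘ) renaming (_+_ to _+ℚ_; _*_ to _*ℚ_)
  open import Data.Rational.Properties
    using (toℚᵘ-injective; toℚᵘ-homo-+; toℚᵘ-homo-*; toℚᵘ-fromℚᵘ)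
  import Data.Rational.Unnormalised as ℚᵘ
  import Data.Rational.Unnormalised.Properties as ℚᵘ
  open import Relation.Binary.PropositionalEquality
  open ≡-Reasoning

  toℚᵘ-/ : (p : ℤ) (k : ℕ) → toℚᵘ (p / suc k) ℚᵘ.≃ ℚᵘ.mkℚᵘ p k
  toℚᵘ-/ p k = toℚᵘ-fromℚᵘ (ℚᵘ.mkℚᵘ p k)

  halving-step : (a b c D : ℕ) .{{_ : NonZero D}} → a ≡ 2 * b + c →
                 _/_ (+ a) (2 * D) {{m*n≢0 2 D}} ≡ + b / D +ℚ ½ *ℚ (+ c / D)
  halving-step _ b c (suc k) refl = toℚᵘ-injective (≃.begin
    toℚᵘ (+ (2 * b + c) / (2 * suc k))
      ≃.≈⟨ toℚᵘ-/ (+ (2 * b + c)) (ℕ.pred (2 * suc k)) ⟩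
    ℚᵘ.mkℚᵘ (+ (2 * b + c)) (ℕ.pred (2 * suc k))
      ≃.≈⟨ ℚᵘ.*≡* cross-multiplied ⟩
    ℚᵘ.mkℚᵘ (+ b) k ℚᵘ.+ ℚᵘ.½ ℚᵘ.* ℚᵘ.mkℚᵘ (+ c) k
      ≃.≈⟨ ℚᵘ.+-cong (toℚᵘ-/ (+ b) k) (ℚᵘ.*-congˡ {ℚᵘ.½} (toℚᵘ-/ (+ c) k)) ⟨
    toℚᵘ (+ b / suc k) ℚᵘ.+ toℚᵘ ½ ℚᵘ.* toℚᵘ (+ c / suc k)
      ≃.≈⟨ ℚᵘ.+-cong (ℚᵘ.≃-refl {toℚᵘ (+ b / suc k)}) (toℚᵘ-homo-* ½ (+ c / suc k)) ⟨
    toℚᵘ (+ b / suc k) ℚᵘ.+ toℚᵘ (½ *ℚ (+ c / suc k))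
      ≃.≈⟨ toℚᵘ-homo-+ (+ b / suc k) (½ *ℚ (+ c / suc k)) ⟨
    toℚᵘ (+ b / suc k +ℚ ½ *ℚ (+ c / suc k)) ≃.∎)
    where
    module ≃ = ℚᵘ.≃-Reasoning
    D = + suc k

    polynomial : (x y d : ℤ) →
      (+ 2 ℤ.* x ℤ.+ y) ℤ.* (d ℤ.* (+ 2 ℤ.* d))
        ≡ (x ℤ.* (+ 2 ℤ.* d) ℤ.+ (+ 1 ℤ.* y) ℤ.* d) ℤ.* (+ 2 ℤ.* d)
    polynomial = ℤ-Solver.solve-∀

    cross-multiplied : + (2 * b + c) ℤ.* (D ℤ.* (+ 2 ℤ.* D))
                     ≡ (+ b ℤ.* (+ 2 ℤ.* D) ℤ.+ (+ 1 ℤ.* + c) ℤ.* D) ℤ.* + (2 * suc k)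
    cross-multiplied = begin
      + (2 * b + c) ℤ.* (D ℤ.* (+ 2 ℤ.* D))
        ≡⟨ cong (ℤ._* (D ℤ.* (+ 2 ℤ.* D))) (trans (pos-+ (2 * b) c) (cong (ℤ._+ + c) (pos-* 2 b))) ⟩
      (+ 2 ℤ.* + b ℤ.+ + c) ℤ.* (D ℤ.* (+ 2 ℤ.* D))
        ≡⟨ polynomial (+ b) (+ c) D ⟩
      (+ b ℤ.* (+ 2 ℤ.* D) ℤ.+ (+ 1 ℤ.* + c) ℤ.* D) ℤ.* (+ 2 ℤ.* D)
        ≡⟨ cong ((+ b ℤ.* (+ 2 ℤ.* D) ℤ.+ (+ 1 ℤ.* + c) ℤ.* D) ℤ.*_) (pos-* 2 (suc k)) ⟨
      (+ b ℤ.* (+ 2 ℤ.* D) ℤ.+ (+ 1 ℤ.* + c) ℤ.* D) ℤ.* + (2 * suc k) ∎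

  fraction-one : (a D : ℕ) .{{_ : NonZero D}} → a ≡ D → + a / D ≡ 1ℚ
  fraction-one _ (suc k) refl =
    toℚᵘ-injective (ℚᵘ.≃-trans (toℚᵘ-/ (+ suc k) k) (ℚᵘ.*≡* (ℤ-*-comm (+ suc k) (+ 1))))

open import Data.Nat using (ℕ; suc; _≤_; _^_)
open import Data.Nat.Properties using (m^n≢0)
open import Data.Product using (_×_; _,_)
open import Data.Rational using (ℚ; _+_; _*_; ½; 1ℚ)
open import Relation.Binary.PropositionalEquality using (_≡_)
open SubsequenceTotals using (totalSubseq; totalSubseq-step; totalSubseq-diag; totalSubseq-empty)
open FractionArithmetic using (halving-step; fraction-one)

-- The recurrence
-- holds for every m.
theorem1 : ((n m : ℕ) → m ≤ n →
    Nhat (suc n) (suc m) ≡ Nhat n m + ½ * Nhat n (suc m))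
    × ((n : ℕ) → Nhat n n ≡ 1ℚ) × ((n : ℕ) → Nhat n 0 ≡ 1ℚ)
theorem1 =
    (λ n m _ → halving-step (totalSubseq (suc n) (suc m)) (totalSubseq n m) (totalSubseq n (suc m))
                            (2 ^ n) {{m^n≢0 2 n}} (totalSubseq-step n m))
  , (λ n → fraction-one (totalSubseq n n) (2 ^ n) {{m^n≢0 2 n}} (totalSubseq-diag n))
  , (λ n → fraction-one (totalSubseq n 0) (2 ^ n) {{m^n≢0 2 n}} (totalSubseq-empty n))
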